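{- Let $\tilde x\in\mathbb{Z}_{\ge 0}^{[m]}$ be a nonnegative integer vector. Then $\tilde x$ is feasible (in the sense defined in the context) if and only if for every subset $J'\subseteq J$ of jobs, $$\sum_{i\in[m]} \min\{|J'(\mathrm{Anc}(i))|,\,g\}\cdot \tilde x(i)\;\ge\; p(J'),$$ where $p(J')=\sum_{j\in J'}p_j$ and $J'(S)=J'\cap J(S)$.
   Context: Laminar active time scheduling instance: a rooted tree whose node set is $[m]$; there is a set $J$ of jobs, each job $j$ with a positive integer processing time $p_j$ and an associated node $K(j)\in[m]$; $g$ is a positive integer capacity. $\mathrm{Des}(i)$ denotes the set of descendants of node $i$ including $i$, $\mathrm{Anc}(i)$ the set of ancestors of $i$ including $i$. $J(i)=\{j\in J: K(j)=i\}$, $J(S)=\bigcup_{i\in S}J(i)$. Here $\tilde x(i)$ is the number of slots opened in node $i$. The vector $\tilde x$ is feasible if there exist nonnegative integers $y(i,j)$ ($i\in[m]$, $j\in J$) with: $\sum_{i\in\mathrm{Des}(K(j))}y(i,j)\ge p_j$ for all $j$; $\sum_{j} y(i,j)\le g\,\tilde x(i)$ for all $i$; $y(i,j)\le \tilde x(i)$ for all $i,j$; and $y(i,j)=0$ whenever $j\notin J(\mathrm{Anc}(i))$ (equivalently $i\notin \mathrm{Des}(K(j))$). That is, every job $j$ can be assigned to $p_j$ distinct open slots in nodes of $\mathrm{Des}(K(j))$ with each open slot receiving at most $g$ jobs. -}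

module Defs where

open import Data.Nat using (ℕ; zero; suc; _+_; _*_; _≤_; _⊔_; _⊓_)
open import Data.Fin using (Fin; zero; suc; _≟_)
open import Data.Bool using (Bool; true; false; if_then_else_; _∧_; _∨_)
open import Data.Product using (Σ; _×_; ∃-syntax)
open import Relation.Nullary.Decidable using (⌊_⌋)
open import Relation.Binary.PropositionalEquality using (_≡_)

∑ : ∀ {k} → (Fin k → ℕ) → ℕ
∑ {zero}  f = 0
∑ {suc k} f = f zero + ∑ (λ i → f (suc i))

iter : ∀ {A : Set} → (A → A) → ℕ → A → A
iter f zero    a = a
iter f (suc k) a = f (iter f k a)

-- A rooted tree on node set Fin m, given by a parent map:
-- the root is its own parent, and every node reaches the root by
-- iterating the parent map (so there are no other cycles / fixed points).
record RootedTree (m : ℕ) : Set where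
  field
    root   : Fin m
    parent : Fin m → Fin m
    parent-root : parent root ≡ root
    reaches-root : ∀ i → ∃[ k ] iter parent k i ≡ root

-- isAnc T a i = true  iff  a ∈ Anc(i) (ancestors of i, including i).
-- In a tree on m nodes every ancestor of i is reached in fewer than m steps.
anySteps : ∀ {m} → (Fin m → Fin m) → Fin m → Fin m → ℕ → Bool
anySteps par a i zero    = false
anySteps par a i (suc k) = ⌊ iter par k i ≟ a ⌋ ∨ anySteps par a i k

isAnc : ∀ {m} → RootedTree m → Fin m → Fin m → Bool
isAnc {m} T a i = anySteps (RootedTree.parent T) a i m

record Instance (m n : ℕ) : Set where
  field
    tree : RootedTree m
    p    : Fin n → ℕ
    p-pos : ∀ j → 1 ≤ p j
    K    : Fin n → Fin m
    g    : ℕ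
    g-pos : 1 ≤ g

module _ {m n : ℕ} (I : Instance m n) where
  open Instance I

  -- i ∈ Des(K(j))  ⇔  K(j) ∈ Anc(i)
  inDes : Fin m → Fin n → Bool
  inDes i j = isAnc tree (K j) i

  Feasible : (Fin m → ℕ) → Set
  Feasible x = Σ (Fin m → Fin n → ℕ) λ y →
      (∀ j → p j ≤ ∑ (λ i → if inDes i j then y i j else 0))
    × (∀ i → ∑ (λ j → y i j) ≤ g * x i)
    × (∀ i j → y i j ≤ x i)
    × (∀ i j → inDes i j ≡ false → y i j ≡ 0)

  -- J' ⊆ J given as a characteristic function.
  -- |J'(Anc(i))|
  countAnc : (Fin n → Bool) → Fin m → ℕ
  countAnc J' i = ∑ (λ j → if J' j ∧ inDes i j then 1 else 0)

  pSum : (Fin n → Bool) → ℕ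
  pSum J' = ∑ (λ j → if J' j then p j else 0)

  HallCondition : (Fin m → ℕ) → Set
  HallCondition x = ∀ (J' : Fin n → Bool) →
    pSum J' ≤ ∑ (λ i → (countAnc J' i ⊓ g) * x i)

{-# OPTIONS --safe #-}
module Submission where

-- Feasibility is a transportation problem: node i offers C i = g · x(i) units in total, at most
-- u i j = x(i) of them to each job j with i ∈ Des(K(j)), and job j needs p j units.  Sufficiency is by induction on the total demand: take a job j₀ with positive demand
-- and try to route one unit of it through some node i, i.e. remove one unit from p j₀, C i and
-- u i j₀.  If for some i the smaller instance still satisfies Hall's condition, recurse.
-- Otherwise every node i is blocked by a tight set of jobs avoiding j₀ that either cannot use i
-- for j₀ or already saturates i.  Since the supply of a set of jobs is submodular, tight sets are
-- closed under union; adding j₀ to the union of all blockers leaves its supply unchanged but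
-- raises its demand, which contradicts Hall's condition.

open import Defs

open import Data.Nat using (ℕ; zero; suc; _+_; _*_; _∸_; _≤_; _<_; _⊓_; z≤n; _≤?_; _<?_)
open import Data.Nat.Properties hiding (_≟_)
open import Data.Nat.Induction using (<-rec)
open import Data.Fin using (Fin; zero; suc; _≟_)
open import Data.Fin.Properties using (any?)
open import Data.Fin.Subset.Properties using (anySubset?)
open import Data.Vec using (lookup; tabulate)
open import Data.Vec.Properties using (lookup∘tabulate)
open import Data.Bool using (Bool; true; false; if_then_else_; _∧_; _∨_)
open import Data.Bool.Properties using (∧-conicalˡ; ∧-conicalʳ; ∧-zeroʳ; ∨-zeroˡ; ∨-zeroʳ)
open import Data.Product using (∃-syntax; _×_; _,_)
open import Data.Sum using (_⊎_; inj₁; inj₂; [_,_]′; map₂)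
open import Data.Empty using (⊥-elim)
open import Function using (_∘_; id)
open import Relation.Nullary using (¬_; does; yes; no)
open import Relation.Nullary.Decidable using (dec-true)
open import Relation.Binary.PropositionalEquality
  using (_≡_; refl; sym; trans; cong; cong₂; subst; subst₂; module ≡-Reasoning)
open import Algebra.Properties.Semiring.Sum +-*-semiring
  using (sum; sum-cong-≗; sum-replicate-zero; ∑-distrib-+; ∑-comm; *-distribˡ-sum; *-distribʳ-sum)

sum-mono-≤ : ∀ {k} {f g : Fin k → ℕ} → (∀ i → f i ≤ g i) → sum f ≤ sum g
sum-mono-≤ {zero}  _   = z≤n
sum-mono-≤ {suc k} f≤g = +-mono-≤ (f≤g zero) (sum-mono-≤ (f≤g ∘ suc))

∑≡sum : ∀ {k} (f : Fin k → ℕ) → ∑ f ≡ sum f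
∑≡sum {zero}  f = refl
∑≡sum {suc k} f = cong (f zero +_) (∑≡sum (f ∘ suc))

𝟙 : Bool → ℕ
𝟙 b = if b then 1 else 0

if-≤ : ∀ b x → (if b then x else 0) ≤ x
if-≤ true  x = ≤-refl
if-≤ false x = z≤n

𝟙*-≤ : ∀ b x → 𝟙 b * x ≤ x
𝟙*-≤ true  x = ≤-reflexive (*-identityˡ x)
𝟙*-≤ false x = z≤n

⊓-concave : ∀ c {a b s t} → t ≤ a → t ≤ b → s + t ≡ a + b → c ⊓ s + c ⊓ t ≤ c ⊓ a + c ⊓ b
⊓-concave c {a} {b} {s} {t} t≤a t≤b s+t≡a+b with c ≤? a | c ≤? b
... | yes c≤a | _ = begin
  c ⊓ s + c ⊓ t  ≤⟨ +-mono-≤ (m⊓n≤m c s) (⊓-monoʳ-≤ c t≤b) ⟩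
  c + c ⊓ b      ≡⟨ cong (_+ c ⊓ b) (m≤n⇒m⊓n≡m c≤a) ⟨
  c ⊓ a + c ⊓ b  ∎
  where open ≤-Reasoning
... | no _ | yes c≤b = begin
  c ⊓ s + c ⊓ t  ≤⟨ +-mono-≤ (m⊓n≤m c s) (⊓-monoʳ-≤ c t≤a) ⟩
  c + c ⊓ a      ≡⟨ +-comm c (c ⊓ a) ⟩
  c ⊓ a + c      ≡⟨ cong (c ⊓ a +_) (m≤n⇒m⊓n≡m c≤b) ⟨
  c ⊓ a + c ⊓ b  ∎
  where open ≤-Reasoning
... | no c≰a | no c≰b = begin
  c ⊓ s + c ⊓ t  ≤⟨ +-mono-≤ (m⊓n≤n c s) (m⊓n≤n c t) ⟩
  s + t          ≡⟨ s+t≡a+b ⟩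
  a + b          ≡⟨ cong₂ _+_ (c≰a⇒c⊓a≡a c≰a) (c≰a⇒c⊓a≡a c≰b) ⟨
  c ⊓ a + c ⊓ b  ∎
  where
  open ≤-Reasoning
  c≰a⇒c⊓a≡a : ∀ {a} → ¬ c ≤ a → c ⊓ a ≡ a
  c≰a⇒c⊓a≡a c≰a = m≥n⇒m⊓n≡n (<⇒≤ (≰⇒> c≰a))

any-or-all : ∀ {k} {A : Set} {B : Fin k → Set} → (∀ i → A ⊎ B i) → A ⊎ (∀ i → B i)
any-or-all {zero}  _ = inj₂ λ ()
any-or-all {suc k} f with f zero | any-or-all (f ∘ suc)
... | inj₁ a | _       = inj₁ a
... | inj₂ _ | inj₁ a  = inj₁ a
... | inj₂ b | inj₂ bs = inj₂ λ { zero → b ; (suc i) → bs i }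

module _ {n : ℕ} where

  sumOver : (Fin n → Bool) → (Fin n → ℕ) → ℕ
  sumOver J f = sum (λ j → if J j then f j else 0)

  ∅ : Fin n → Bool
  ∅ _ = false

  ⁅_⁆ : Fin n → Fin n → Bool
  ⁅ a ⁆ b = does (a ≟ b)

  _∪_ _∩_ : (Fin n → Bool) → (Fin n → Bool) → Fin n → Bool
  (J ∪ K) j = J j ∨ K j
  (J ∩ K) j = J j ∧ K j

  δ : Fin n → Fin n → ℕ
  δ a = 𝟙 ∘ ⁅ a ⁆

  sumOver-≤-sum : ∀ J f → sumOver J f ≤ sum f
  sumOver-≤-sum J f = sum-mono-≤ (λ j → if-≤ (J j) (f j))

  sumOver-mono : ∀ J {f g} → (∀ j → f j ≤ g j) → sumOver J f ≤ sumOver J g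
  sumOver-mono J f≤g = sum-mono-≤ (λ j → mono (J j) (f≤g j))
    where
    mono : ∀ b {x y} → x ≤ y → (if b then x else 0) ≤ (if b then y else 0)
    mono true  x≤y = x≤y
    mono false _   = z≤n

  sumOver-⊆ : ∀ {J K} f → (∀ j → J j ≡ true → K j ≡ true) → sumOver J f ≤ sumOver K f
  sumOver-⊆ {J} {K} f J⊆K = sum-mono-≤ (λ j → mono (J j) (K j) (J⊆K j))
    where
    mono : ∀ b c {x} → (b ≡ true → c ≡ true) → (if b then x else 0) ≤ (if c then x else 0)
    mono true  c b⇒c rewrite b⇒c refl = ≤-refl
    mono false c _   = z≤n

  sumOver-congˡ : ∀ {J K} f → (∀ j → J j ≡ K j) → sumOver J f ≡ sumOver K f
  sumOver-congˡ f J≗K = sum-cong-≗ (λ j → cong (λ b → if b then f j else 0) (J≗K j))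

  sumOver-congʳ : ∀ J {f g} → (∀ j → f j ≡ g j) → sumOver J f ≡ sumOver J g
  sumOver-congʳ J f≗g = sum-cong-≗ (λ j → cong (λ x → if J j then x else 0) (f≗g j))

  sumOver-∅ : ∀ f → sumOver ∅ f ≡ 0
  sumOver-∅ f = sum-replicate-zero n

  sumOver-+ : ∀ J f g → sumOver J (λ j → f j + g j) ≡ sumOver J f + sumOver J g
  sumOver-+ J f g = trans (sum-cong-≗ (λ j → split (J j)))
                          (∑-distrib-+ (λ j → if J j then f j else 0) (λ j → if J j then g j else 0))
    where
    split : ∀ b {x y} → (if b then x + y else 0) ≡ (if b then x else 0) + (if b then y else 0)
    split true  = refl
    split false = refl

  sumOver-sum : ∀ {m} J (F : Fin m → Fin n → ℕ) →
                sumOver J (λ j → sum (λ k → F k j)) ≡ sum (λ k → sumOver J (F k))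
  sumOver-sum {m} J F = trans (sum-cong-≗ (λ j → push (J j)))
                              (sym (∑-comm (λ k j → if J j then F k j else 0)))
    where
    push : ∀ b {g : Fin m → ℕ} → (if b then sum g else 0) ≡ sum (λ k → if b then g k else 0)
    push true  = refl
    push false = sym (sum-replicate-zero m)

  sumOver-modular : ∀ J K f → sumOver (J ∪ K) f + sumOver (J ∩ K) f ≡ sumOver J f + sumOver K f
  sumOver-modular J K f = begin
    sumOver (J ∪ K) f + sumOver (J ∩ K) f
      ≡⟨ ∑-distrib-+ (λ j → if J j ∨ K j then f j else 0) (λ j → if J j ∧ K j then f j else 0) ⟨
    sum (λ j → (if J j ∨ K j then f j else 0) + (if J j ∧ K j then f j else 0))
      ≡⟨ sum-cong-≗ (λ j → pointwise (J j) (K j)) ⟩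
    sum (λ j → (if J j then f j else 0) + (if K j then f j else 0))
      ≡⟨ ∑-distrib-+ (λ j → if J j then f j else 0) (λ j → if K j then f j else 0) ⟩
    sumOver J f + sumOver K f ∎
    where
    open ≡-Reasoning
    pointwise : ∀ b c {x} → (if b ∨ c then x else 0) + (if b ∧ c then x else 0)
                          ≡ (if b then x else 0) + (if c then x else 0)
    pointwise true  true  = refl
    pointwise true  false = refl
    pointwise false true  = +-comm _ 0
    pointwise false false = refl

sumOver-⁅⁆ : ∀ {n} (a : Fin n) f → sumOver ⁅ a ⁆ f ≡ f a
sumOver-⁅⁆ {suc n} zero    f = trans (cong (f zero +_) (sum-replicate-zero n)) (+-identityʳ (f zero))
sumOver-⁅⁆ {suc n} (suc a) f = sumOver-⁅⁆ a (f ∘ suc)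

module _ {n : ℕ} where

  sumOver-∪⁅⁆ : ∀ {J : Fin n → Bool} {a} f → J a ≡ false → sumOver (J ∪ ⁅ a ⁆) f ≡ sumOver J f + f a
  sumOver-∪⁅⁆ {J} {a} f a∉J = begin
    sumOver (J ∪ ⁅ a ⁆) f
      ≡⟨ +-identityʳ (sumOver (J ∪ ⁅ a ⁆) f) ⟨
    sumOver (J ∪ ⁅ a ⁆) f + 0
      ≡⟨ cong (sumOver (J ∪ ⁅ a ⁆) f +_) (trans (sumOver-congˡ f disjoint) (sumOver-∅ f)) ⟨
    sumOver (J ∪ ⁅ a ⁆) f + sumOver (J ∩ ⁅ a ⁆) f
      ≡⟨ sumOver-modular J ⁅ a ⁆ f ⟩
    sumOver J f + sumOver ⁅ a ⁆ f
      ≡⟨ cong (sumOver J f +_) (sumOver-⁅⁆ a f) ⟩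
    sumOver J f + f a ∎
    where
    open ≡-Reasoning
    disjoint : ∀ j → J j ∧ ⁅ a ⁆ j ≡ false
    disjoint j with a ≟ j
    ... | yes refl = cong (_∧ true) a∉J
    ... | no  _    = ∧-zeroʳ (J j)

  δ-diag : ∀ (a : Fin n) → δ a a ≡ 1
  δ-diag a = cong 𝟙 (dec-true (a ≟ a) refl)

  sum-δ : ∀ (a : Fin n) → sum (δ a) ≡ 1
  sum-δ a = sumOver-⁅⁆ a (λ _ → 1)

  sumOver-δ : ∀ J (a : Fin n) → sumOver J (δ a) ≡ 𝟙 (J a)
  sumOver-δ J a = trans (sum-cong-≗ (λ j → swap (J j) (⁅ a ⁆ j))) (sumOver-⁅⁆ a (𝟙 ∘ J))
    where
    swap : ∀ b c → (if b then 𝟙 c else 0) ≡ (if c then 𝟙 b else 0)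
    swap true  true  = refl
    swap true  false = refl
    swap false true  = refl
    swap false false = refl

  sum-*δ : ∀ c (a : Fin n) → sum (λ b → c * δ a b) ≡ c
  sum-*δ c a = trans (sym (*-distribˡ-sum c (δ a))) (trans (cong (c *_) (sum-δ a)) (*-identityʳ c))

  sum-δ* : ∀ (a : Fin n) c → sum (λ b → δ a b * c) ≡ c
  sum-δ* a c = trans (sym (*-distribʳ-sum c (δ a))) (trans (cong (_* c) (sum-δ a)) (*-identityˡ c))

  δ≤ : ∀ {f : Fin n → ℕ} {a} → 1 ≤ f a → ∀ b → δ a b ≤ f b
  δ≤ {a = a} 1≤fa b with a ≟ b
  ... | yes refl = 1≤fa
  ... | no  _    = z≤n

⋃ : ∀ {k n} → (Fin k → Fin n → Bool) → Fin n → Bool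
⋃ {zero}  W = ∅
⋃ {suc k} W = W zero ∪ ⋃ (W ∘ suc)

⊆-⋃ : ∀ {k n} (W : Fin k → Fin n → Bool) i j → W i j ≡ true → ⋃ W j ≡ true
⊆-⋃ W zero    j j∈W = trans (cong (_∨ ⋃ (W ∘ suc) j) j∈W) (∨-zeroˡ (⋃ (W ∘ suc) j))
⊆-⋃ W (suc i) j j∈W = trans (cong (W zero j ∨_) (⊆-⋃ (W ∘ suc) i j j∈W)) (∨-zeroʳ (W zero j))

∉-⋃ : ∀ {k n} (W : Fin k → Fin n → Bool) j → (∀ i → W i j ≡ false) → ⋃ W j ≡ false
∉-⋃ {zero}  W j _   = refl
∉-⋃ {suc k} W j j∉W = trans (cong (_∨ ⋃ (W ∘ suc) j) (j∉W zero)) (∉-⋃ (W ∘ suc) j (j∉W ∘ suc))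

module _ {m n : ℕ} where

  supply : (Fin m → ℕ) → (Fin m → Fin n → ℕ) → (Fin n → Bool) → ℕ
  supply C u J = sum (λ k → C k ⊓ sumOver J (u k))

  Hall : (Fin n → ℕ) → (Fin m → ℕ) → (Fin m → Fin n → ℕ) → Set
  Hall p C u = ∀ J → sumOver J p ≤ supply C u J

  Tight : (Fin n → ℕ) → (Fin m → ℕ) → (Fin m → Fin n → ℕ) → (Fin n → Bool) → Set
  Tight p C u J = supply C u J ≤ sumOver J p

  record Assignment (p : Fin n → ℕ) (C : Fin m → ℕ) (u : Fin m → Fin n → ℕ) : Set where
    field
      flow    : Fin m → Fin n → ℕ
      flow≤u  : ∀ k j → flow k j ≤ u k j
      rows≤C  : ∀ k → sum (flow k) ≤ C k
      p≤cols  : ∀ j → p j ≤ sum (λ k → flow k j)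

  HallSufficientBelow : ℕ → Set
  HallSufficientBelow N =
    ∀ {p : Fin n → ℕ} {C : Fin m → ℕ} {u} → sum p < N → Hall p C u → Assignment p C u

  assignment⇒hall : ∀ {p C u} → Assignment p C u → Hall p C u
  assignment⇒hall {p} {C} {u} a J = begin
    sumOver J p                             ≤⟨ sumOver-mono J p≤cols ⟩
    sumOver J (λ j → sum (λ k → flow k j))  ≡⟨ sumOver-sum J flow ⟩
    sum (λ k → sumOver J (flow k))          ≤⟨ sum-mono-≤ (λ k → ⊓-glb (row-bound k)
                                                                       (sumOver-mono J (flow≤u k))) ⟩
    supply C u J                            ∎
    where
    open Assignment a
    open ≤-Reasoning
    row-bound : ∀ k → sumOver J (flow k) ≤ C k
    row-bound k = ≤-trans (sumOver-≤-sum J (flow k)) (rows≤C k)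

  assignment-zero : ∀ {p : Fin n → ℕ} {C : Fin m → ℕ} {u} → (∀ j → p j ≡ 0) → Assignment p C u
  assignment-zero p≡0 = record
    { flow   = λ _ _ → 0
    ; flow≤u = λ _ _ → z≤n
    ; rows≤C = λ k → subst (_≤ _) (sym (sum-replicate-zero n)) z≤n
    ; p≤cols = λ j → subst (_≤ _) (sym (p≡0 j)) z≤n
    }

  hall-or-violation : ∀ p C u → Hall p C u ⊎ ∃[ J ] supply C u J < sumOver J p
  hall-or-violation p C u with anySubset? (λ s → supply C u (lookup s) <? sumOver (lookup s) p)
  ... | yes (s , violated) = inj₂ (lookup s , violated)
  ... | no  no-violation   = inj₁ λ J →
    subst₂ _≤_ (sumOver-congˡ p (lookup∘tabulate J)) (supply-cong (lookup∘tabulate J))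
           (≮⇒≥ (no-violation ∘ (tabulate J ,_)))
    where
    supply-cong : ∀ {J K} → (∀ j → J j ≡ K j) → supply C u J ≡ supply C u K
    supply-cong J≗K = sum-cong-≗ (λ k → cong (C k ⊓_) (sumOver-congˡ (u k) J≗K))

module _ {m n : ℕ} {p : Fin n → ℕ} {C : Fin m → ℕ} {u : Fin m → Fin n → ℕ} where

  supply-submodular : ∀ J K → supply C u (J ∪ K) + supply C u (J ∩ K) ≤ supply C u J + supply C u K
  supply-submodular J K = begin
    supply C u (J ∪ K) + supply C u (J ∩ K)
      ≡⟨ ∑-distrib-+ (λ k → C k ⊓ sumOver (J ∪ K) (u k)) (λ k → C k ⊓ sumOver (J ∩ K) (u k)) ⟨
    sum (λ k → C k ⊓ sumOver (J ∪ K) (u k) + C k ⊓ sumOver (J ∩ K) (u k))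
      ≤⟨ sum-mono-≤ (λ k → ⊓-concave (C k) (sumOver-⊆ (u k) (λ j → ∧-conicalˡ (J j) (K j)))
                                           (sumOver-⊆ (u k) (λ j → ∧-conicalʳ (J j) (K j)))
                                           (sumOver-modular J K (u k))) ⟩
    sum (λ k → C k ⊓ sumOver J (u k) + C k ⊓ sumOver K (u k))
      ≡⟨ ∑-distrib-+ (λ k → C k ⊓ sumOver J (u k)) (λ k → C k ⊓ sumOver K (u k)) ⟩
    supply C u J + supply C u K ∎
    where open ≤-Reasoning

  tight-∅ : Tight p C u ∅
  tight-∅ = begin
    supply C u ∅                 ≤⟨ sum-mono-≤ (λ k → m⊓n≤n (C k) (sumOver ∅ (u k))) ⟩
    sum (λ k → sumOver ∅ (u k))  ≡⟨ sum-cong-≗ (λ k → sumOver-∅ (u k)) ⟩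
    sum (λ (k : Fin m) → 0)      ≡⟨ sum-replicate-zero m ⟩
    0                            ≤⟨ z≤n ⟩
    sumOver ∅ p                  ∎
    where open ≤-Reasoning

  module _ (hall : Hall p C u) where

    tight-∪ : ∀ {J K} → Tight p C u J → Tight p C u K → Tight p C u (J ∪ K)
    tight-∪ {J} {K} tight-J tight-K = +-cancelʳ-≤ (supply C u (J ∩ K)) _ _ (begin
      supply C u (J ∪ K) + supply C u (J ∩ K)  ≤⟨ supply-submodular J K ⟩
      supply C u J + supply C u K              ≤⟨ +-mono-≤ tight-J tight-K ⟩
      sumOver J p + sumOver K p                ≡⟨ sumOver-modular J K p ⟨
      sumOver (J ∪ K) p + sumOver (J ∩ K) p    ≤⟨ +-monoʳ-≤ (sumOver (J ∪ K) p) (hall (J ∩ K)) ⟩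
      sumOver (J ∪ K) p + supply C u (J ∩ K)   ∎)
      where open ≤-Reasoning

    tight-⋃ : ∀ {k} (W : Fin k → Fin n → Bool) → (∀ i → Tight p C u (W i)) → Tight p C u (⋃ W)
    tight-⋃ {zero}  W _     = tight-∅
    tight-⋃ {suc k} W tight = tight-∪ (tight zero) (tight-⋃ (W ∘ suc) (tight ∘ suc))

module _ {m n : ℕ} (p : Fin n → ℕ) (C : Fin m → ℕ) (u : Fin m → Fin n → ℕ) (j₀ : Fin n) where

  record Blocker (i : Fin m) : Set where
    field
      J        : Fin n → Bool
      J-tight  : Tight p C u J
      j₀∉J     : J j₀ ≡ false
      i-closed : u i j₀ ≡ 0 ⊎ C i ≤ sumOver J (u i)

  ∅-blocker : ∀ {i} → u i j₀ ≡ 0 ⊎ C i ≡ 0 → Blocker i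
  ∅-blocker closed = record
    { J        = ∅
    ; J-tight  = tight-∅ {p = p} {C} {u}
    ; j₀∉J     = refl
    ; i-closed = map₂ (λ C≡0 → subst (_≤ _) (sym C≡0) z≤n) closed
    }

  ¬all-blocked : Hall p C u → 1 ≤ p j₀ → ¬ (∀ i → Blocker i)
  ¬all-blocked hall p≥1 blocker = <⇒≱ p≥1 (+-cancelˡ-≤ (sumOver T p) (p j₀) 0 (begin
    sumOver T p + p j₀        ≡⟨ sumOver-∪⁅⁆ p j₀∉T ⟨
    sumOver (T ∪ ⁅ j₀ ⁆) p    ≤⟨ hall (T ∪ ⁅ j₀ ⁆) ⟩
    supply C u (T ∪ ⁅ j₀ ⁆)   ≤⟨ sum-mono-≤ no-gain ⟩
    supply C u T              ≤⟨ tight-⋃ {p = p} {C} {u} hall W (J-tight ∘ blocker) ⟩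
    sumOver T p               ≡⟨ +-identityʳ (sumOver T p) ⟨
    sumOver T p + 0           ∎))
    where
    open Blocker
    open ≤-Reasoning
    W : Fin m → Fin n → Bool
    W = J ∘ blocker
    T : Fin n → Bool
    T = ⋃ W
    j₀∉T : T j₀ ≡ false
    j₀∉T = ∉-⋃ W j₀ (j₀∉J ∘ blocker)
    no-gain : ∀ k → C k ⊓ sumOver (T ∪ ⁅ j₀ ⁆) (u k) ≤ C k ⊓ sumOver T (u k)
    no-gain k with i-closed (blocker k)
    ... | inj₁ u≡0 = ≤-reflexive (cong (C k ⊓_) (begin-equality
      sumOver (T ∪ ⁅ j₀ ⁆) (u k)  ≡⟨ sumOver-∪⁅⁆ (u k) j₀∉T ⟩
      sumOver T (u k) + u k j₀    ≡⟨ cong (sumOver T (u k) +_) u≡0 ⟩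
      sumOver T (u k) + 0         ≡⟨ +-identityʳ (sumOver T (u k)) ⟩
      sumOver T (u k)             ∎))
    ... | inj₂ saturated =
      ≤-trans (m⊓n≤m (C k) _) (⊓-glb ≤-refl (≤-trans saturated (sumOver-⊆ (u k) (⊆-⋃ W k))))

module UnitStep {m n : ℕ} {p p′ : Fin n → ℕ} {C C′ : Fin m → ℕ} {u u′ : Fin m → Fin n → ℕ}
  (i : Fin m) (j₀ : Fin n)
  (p≡ : ∀ j → p j ≡ δ j₀ j + p′ j)
  (C≡ : ∀ k → C k ≡ δ i k + C′ k)
  (u≡ : ∀ k j → u k j ≡ δ i k * δ j₀ j + u′ k j)
  where

  unit : Fin m → Fin n → ℕ
  unit k j = δ i k * δ j₀ j

  sum-p : sum p ≡ suc (sum p′)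
  sum-p = begin
    sum p                      ≡⟨ sum-cong-≗ p≡ ⟩
    sum (λ j → δ j₀ j + p′ j)  ≡⟨ ∑-distrib-+ (δ j₀) p′ ⟩
    sum (δ j₀) + sum p′        ≡⟨ cong (_+ sum p′) (sum-δ j₀) ⟩
    suc (sum p′)               ∎
    where open ≡-Reasoning

  lift : Assignment p′ C′ u′ → Assignment p C u
  lift a = record
    { flow   = flow↑
    ; flow≤u = λ k j → ≤-trans (+-monoʳ-≤ (unit k j) (flow≤u k j)) (≤-reflexive (sym (u≡ k j)))
    ; rows≤C = rows
    ; p≤cols = cols
    }
    where
    open Assignment a
    open ≤-Reasoning
    flow↑ : Fin m → Fin n → ℕ
    flow↑ k j = unit k j + flow k j
    rows : ∀ k → sum (flow↑ k) ≤ C k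
    rows k = begin
      sum (flow↑ k)                   ≡⟨ ∑-distrib-+ (unit k) (flow k) ⟩
      sum (unit k) + sum (flow k)     ≡⟨ cong (_+ sum (flow k)) (sum-*δ (δ i k) j₀) ⟩
      δ i k + sum (flow k)            ≤⟨ +-monoʳ-≤ (δ i k) (rows≤C k) ⟩
      δ i k + C′ k                    ≡⟨ C≡ k ⟨
      C k                             ∎
    cols : ∀ j → p j ≤ sum (λ k → flow↑ k j)
    cols j = begin
      p j                                               ≡⟨ p≡ j ⟩
      δ j₀ j + p′ j
        ≤⟨ +-monoʳ-≤ (δ j₀ j) (p≤cols j) ⟩
      δ j₀ j + sum (λ k → flow k j)
        ≡⟨ cong (_+ sum (λ k → flow k j)) (sum-δ* i (δ j₀ j)) ⟨
      sum (λ k → unit k j) + sum (λ k → flow k j)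
        ≡⟨ ∑-distrib-+ (λ k → unit k j) (λ k → flow k j) ⟨
      sum (λ k → flow↑ k j) ∎

  sumOver-p : ∀ J → sumOver J p ≡ 𝟙 (J j₀) + sumOver J p′
  sumOver-p J = begin
    sumOver J p                      ≡⟨ sumOver-congʳ J p≡ ⟩
    sumOver J (λ j → δ j₀ j + p′ j)  ≡⟨ sumOver-+ J (δ j₀) p′ ⟩
    sumOver J (δ j₀) + sumOver J p′  ≡⟨ cong (_+ sumOver J p′) (sumOver-δ J j₀) ⟩
    𝟙 (J j₀) + sumOver J p′          ∎
    where open ≡-Reasoning

  sumOver-u : ∀ J k → sumOver J (u k) ≡ sumOver J (unit k) + sumOver J (u′ k)
  sumOver-u J k = trans (sumOver-congʳ J (u≡ k)) (sumOver-+ J (unit k) (u′ k))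

  sumOver-unit≤ : ∀ J k → sumOver J (unit k) ≤ 𝟙 (J j₀)
  sumOver-unit≤ J k = ≤-trans (sumOver-mono J (λ j → 𝟙*-≤ (⁅ i ⁆ k) (δ j₀ j)))
                              (≤-reflexive (sumOver-δ J j₀))

  supply-term≤ : ∀ J k → C k ⊓ sumOver J (u k) ≤ δ i k + C′ k ⊓ sumOver J (u′ k)
  supply-term≤ J k = begin
    C k ⊓ sumOver J (u k)
      ≡⟨ cong₂ _⊓_ (C≡ k) (sumOver-u J k) ⟩
    (δ i k + C′ k) ⊓ (sumOver J (unit k) + sumOver J (u′ k))
      ≤⟨ ⊓-monoʳ-≤ (δ i k + C′ k) (+-monoˡ-≤ (sumOver J (u′ k)) unit≤δ) ⟩
    (δ i k + C′ k) ⊓ (δ i k + sumOver J (u′ k))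
      ≡⟨ +-distribˡ-⊓ (δ i k) (C′ k) (sumOver J (u′ k)) ⟨
    δ i k + C′ k ⊓ sumOver J (u′ k) ∎
    where
    open ≤-Reasoning
    unit≤δ : sumOver J (unit k) ≤ δ i k
    unit≤δ = ≤-trans (sumOver-≤-sum J (unit k)) (≤-reflexive (sum-*δ (δ i k) j₀))

  supply≤ : ∀ J → supply C u J ≤ suc (supply C′ u′ J)
  supply≤ J = begin
    supply C u J
      ≤⟨ sum-mono-≤ (supply-term≤ J) ⟩
    sum (λ k → δ i k + C′ k ⊓ sumOver J (u′ k))
      ≡⟨ ∑-distrib-+ (δ i) (λ k → C′ k ⊓ sumOver J (u′ k)) ⟩
    sum (δ i) + supply C′ u′ J
      ≡⟨ cong (_+ supply C′ u′ J) (sum-δ i) ⟩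
    suc (supply C′ u′ J) ∎
    where open ≤-Reasoning

  supply≤-unsaturated : ∀ J → J j₀ ≡ false → sumOver J (u i) < C i →
                        supply C u J ≤ supply C′ u′ J
  supply≤-unsaturated J j₀∉J unsaturated = sum-mono-≤ term≤
    where
    term≤ : ∀ k → C k ⊓ sumOver J (u k) ≤ C′ k ⊓ sumOver J (u′ k)
    term≤ k with i ≟ k | supply-term≤ J k
    ... | no  _    | bound = bound
    ... | yes refl | _     = begin
      C i ⊓ sumOver J (u i)    ≡⟨ m≥n⇒m⊓n≡n (<⇒≤ unsaturated) ⟩
      sumOver J (u i)          ≤⟨ ⊓-glb ≤C′ ≤u′ ⟩
      C′ i ⊓ sumOver J (u′ i)  ∎
      where
      open ≤-Reasoning
      ≤C′ : sumOver J (u i) ≤ C′ i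
      ≤C′ = ≤-pred (subst (sumOver J (u i) <_) (trans (C≡ i) (cong (_+ C′ i) (δ-diag i))) unsaturated)
      ≤u′ : sumOver J (u i) ≤ sumOver J (u′ i)
      ≤u′ = ≤-trans (≤-reflexive (sumOver-u J i))
                    (+-monoˡ-≤ (sumOver J (u′ i))
                               (subst (λ b → sumOver J (unit i) ≤ 𝟙 b) j₀∉J (sumOver-unit≤ J i)))

  violation⇒blocking : Hall p C u → ∀ J → supply C′ u′ J < sumOver J p′ →
                       Tight p C u J × J j₀ ≡ false × C i ≤ sumOver J (u i)
  violation⇒blocking hall J violated with J j₀ in j₀∈?J | sumOver-p J
  ... | true  | split = ⊥-elim (<⇒≱ violated (≤-pred (begin
    suc (sumOver J p′)    ≡⟨ split ⟨
    sumOver J p           ≤⟨ hall J ⟩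
    supply C u J          ≤⟨ supply≤ J ⟩
    suc (supply C′ u′ J)  ∎)))
    where open ≤-Reasoning
  ... | false | split with C i ≤? sumOver J (u i)
  ...   | yes saturated = tight , refl , saturated
    where
    open ≤-Reasoning
    tight : Tight p C u J
    tight = begin
      supply C u J          ≤⟨ supply≤ J ⟩
      suc (supply C′ u′ J)  ≤⟨ violated ⟩
      sumOver J p′          ≡⟨ split ⟨
      sumOver J p           ∎
  ...   | no unsaturated = ⊥-elim (<⇒≱ violated (begin
    sumOver J p′    ≡⟨ split ⟨
    sumOver J p     ≤⟨ hall J ⟩
    supply C u J    ≤⟨ supply≤-unsaturated J j₀∈?J (≰⇒> unsaturated) ⟩
    supply C′ u′ J  ∎))
    where open ≤-Reasoning

module UnitReduction {m n : ℕ} {p : Fin n → ℕ} {C : Fin m → ℕ} {u : Fin m → Fin n → ℕ}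
  (i : Fin m) (j₀ : Fin n) (p≥1 : 1 ≤ p j₀) (C≥1 : 1 ≤ C i) (u≥1 : 1 ≤ u i j₀)
  where

  p′ : Fin n → ℕ
  p′ j = p j ∸ δ j₀ j

  C′ : Fin m → ℕ
  C′ k = C k ∸ δ i k

  u′ : Fin m → Fin n → ℕ
  u′ k j = u k j ∸ δ i k * δ j₀ j

  p≡ : ∀ j → p j ≡ δ j₀ j + p′ j
  p≡ j = sym (m+[n∸m]≡n (δ≤ {f = p} {a = j₀} p≥1 j))

  C≡ : ∀ k → C k ≡ δ i k + C′ k
  C≡ k = sym (m+[n∸m]≡n (δ≤ {f = C} {a = i} C≥1 k))

  u≡ : ∀ k j → u k j ≡ δ i k * δ j₀ j + u′ k j
  u≡ k j = sym (m+[n∸m]≡n (unit≤u k j))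
    where
    unit≤u : ∀ k j → δ i k * δ j₀ j ≤ u k j
    unit≤u k j with i ≟ k
    ... | yes refl = ≤-trans (𝟙*-≤ true (δ j₀ j)) (δ≤ {f = u i} {a = j₀} u≥1 j)
    ... | no  _    = z≤n

  open UnitStep i j₀ p≡ C≡ u≡

  reduce-or-block : Hall p C u → HallSufficientBelow (sum p) → Assignment p C u ⊎ Blocker p C u j₀ i
  reduce-or-block hall recurse with hall-or-violation p′ C′ u′
  ... | inj₁ hall′ = inj₁ (lift (recurse {p′} {C′} {u′} (≤-reflexive (sym sum-p)) hall′))
  ... | inj₂ (J , violated) with violation⇒blocking hall J violated
  ...   | tight , j₀∉J , saturated =
    inj₂ (record { J = J ; J-tight = tight ; j₀∉J = j₀∉J ; i-closed = inj₂ saturated })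

module _ {m n : ℕ} where

  hall⇒assignment-step : ∀ {p : Fin n → ℕ} {C : Fin m → ℕ} {u} →
                         HallSufficientBelow (sum p) → Hall p C u → Assignment p C u
  hall⇒assignment-step {p} {C} {u} recurse hall with any? (λ j → 1 ≤? p j)
  ... | no  no-demand  = assignment-zero (λ j → n<1⇒n≡0 (≰⇒> (no-demand ∘ (j ,_))))
  ... | yes (j₀ , p≥1) =
    [ id , ⊥-elim ∘ ¬all-blocked p C u j₀ hall p≥1 ]′ (any-or-all reduce-or-block)
    where
    reduce-or-block : ∀ i → Assignment p C u ⊎ Blocker p C u j₀ i
    reduce-or-block i with 1 ≤? C i | 1 ≤? u i j₀
    ... | no C≱1  | _       = inj₂ (∅-blocker p C u j₀ (inj₂ (n<1⇒n≡0 (≰⇒> C≱1))))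
    ... | yes _   | no u≱1  = inj₂ (∅-blocker p C u j₀ (inj₁ (n<1⇒n≡0 (≰⇒> u≱1))))
    ... | yes C≥1 | yes u≥1 = UnitReduction.reduce-or-block i j₀ p≥1 C≥1 u≥1 hall recurse

  hall⇒assignment : ∀ {p : Fin n → ℕ} {C : Fin m → ℕ} {u} → Hall p C u → Assignment p C u
  hall⇒assignment {p} = <-rec P step (sum p) refl
    where
    P : ℕ → Set
    P N = ∀ {p : Fin n → ℕ} {C : Fin m → ℕ} {u} → sum p ≡ N → Hall p C u → Assignment p C u
    step : ∀ N → (∀ {N′} → N′ < N → P N′) → P N
    step N rec refl = hall⇒assignment-step (λ smaller → rec smaller refl)

≤-if : ∀ b {y z} → y ≤ z → (b ≡ false → y ≡ 0) → y ≤ (if b then z else 0)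
≤-if true  y≤z _   = y≤z
≤-if false _   y≡0 = ≤-reflexive (y≡0 refl)

≤-if-self : ∀ b {y z} → y ≤ (if b then z else 0) → y ≤ (if b then y else 0)
≤-if-self true  _   = ≤-refl
≤-if-self false y≤0 = y≤0

module _ {m n : ℕ} (I : Instance m n) (x : Fin m → ℕ) where
  open Instance I

  slots : Fin m → ℕ
  slots i = g * x i

  access : Fin m → Fin n → ℕ
  access i j = if inDes I i j then x i else 0

  feasible⇒assignment : Feasible I x → Assignment p slots access
  feasible⇒assignment (y , covered , rows , y≤x , y-supported) = record
    { flow   = y
    ; flow≤u = λ i j → ≤-if (inDes I i j) (y≤x i j) (y-supported i j)
    ; rows≤C = λ i → subst (_≤ slots i) (∑≡sum (y i)) (rows i)
    ; p≤cols = λ j → ≤-trans (covered j) (cols≤ j)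
    }
    where
    cols≤ : ∀ j → ∑ (λ i → if inDes I i j then y i j else 0) ≤ sum (λ i → y i j)
    cols≤ j = subst (_≤ sum (λ i → y i j)) (sym (∑≡sum (λ i → if inDes I i j then y i j else 0)))
                    (sum-mono-≤ (λ i → if-≤ (inDes I i j) (y i j)))

  assignment⇒feasible : Assignment p slots access → Feasible I x
  assignment⇒feasible a = flow , covered , rows , flow≤x , supported
    where
    open Assignment a
    covered : ∀ j → p j ≤ ∑ (λ i → if inDes I i j then flow i j else 0)
    covered j = ≤-trans (p≤cols j)
                  (subst (sum (λ i → flow i j) ≤_) (sym (∑≡sum (λ i → if inDes I i j then flow i j else 0)))
                         (sum-mono-≤ (λ i → ≤-if-self (inDes I i j) (flow≤u i j))))
    rows : ∀ i → ∑ (flow i) ≤ slots i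
    rows i = subst (_≤ slots i) (sym (∑≡sum (flow i))) (rows≤C i)
    flow≤x : ∀ i j → flow i j ≤ x i
    flow≤x i j = ≤-trans (flow≤u i j) (if-≤ (inDes I i j) (x i))
    supported : ∀ i j → inDes I i j ≡ false → flow i j ≡ 0
    supported i j outside =
      n≤0⇒n≡0 (subst (λ b → flow i j ≤ (if b then x i else 0)) outside (flow≤u i j))

  supply≡ : ∀ J → supply slots access J ≡ ∑ (λ i → (countAnc I J i ⊓ g) * x i)
  supply≡ J = begin
    supply slots access J                   ≡⟨ sum-cong-≗ term≡ ⟩
    sum (λ i → (countAnc I J i ⊓ g) * x i)  ≡⟨ ∑≡sum (λ i → (countAnc I J i ⊓ g) * x i) ⟨
    ∑ (λ i → (countAnc I J i ⊓ g) * x i)    ∎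
    where
    open ≡-Reasoning
    indicator-* : ∀ b c {z} → (if b then (if c then z else 0) else 0) ≡ (if b ∧ c then 1 else 0) * z
    indicator-* true  true  = sym (+-identityʳ _)
    indicator-* true  false = refl
    indicator-* false _     = refl
    term≡ : ∀ i → slots i ⊓ sumOver J (access i) ≡ (countAnc I J i ⊓ g) * x i
    term≡ i = begin
      g * x i ⊓ sumOver J (access i)
        ≡⟨ cong (g * x i ⊓_) (sum-cong-≗ (λ j → indicator-* (J j) (inDes I i j))) ⟩
      g * x i ⊓ sum (λ j → (if J j ∧ inDes I i j then 1 else 0) * x i)
        ≡⟨ cong (g * x i ⊓_) (*-distribʳ-sum (x i) (λ j → if J j ∧ inDes I i j then 1 else 0)) ⟨
      g * x i ⊓ (sum (λ j → if J j ∧ inDes I i j then 1 else 0) * x i)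
        ≡⟨ cong (λ c → g * x i ⊓ (c * x i)) (∑≡sum (λ j → if J j ∧ inDes I i j then 1 else 0)) ⟨
      g * x i ⊓ (countAnc I J i * x i)
        ≡⟨ *-distribʳ-⊓ (x i) g (countAnc I J i) ⟨
      (g ⊓ countAnc I J i) * x i
        ≡⟨ cong (_* x i) (⊓-comm g (countAnc I J i)) ⟩
      (countAnc I J i ⊓ g) * x i ∎

  pSum≡sumOver : ∀ J → pSum I J ≡ sumOver J p
  pSum≡sumOver J = ∑≡sum (λ j → if J j then p j else 0)

  hallCondition⇒hall : HallCondition I x → Hall p slots access
  hallCondition⇒hall hall J = subst₂ _≤_ (pSum≡sumOver J) (sym (supply≡ J)) (hall J)

  hall⇒hallCondition : Hall p slots access → HallCondition I x
  hall⇒hallCondition hall J = subst₂ _≤_ (sym (pSum≡sumOver J)) (supply≡ J) (hall J)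

lemma2 : ∀ {m n : ℕ} (I : Instance m n) (x : Fin m → ℕ) →
    (Feasible I x → HallCondition I x) × (HallCondition I x → Feasible I x)
lemma2 I x = hall⇒hallCondition I x ∘ assignment⇒hall ∘ feasible⇒assignment I x
           , assignment⇒feasible I x ∘ hall⇒assignment ∘ hallCondition⇒hall I x
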